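{- Let $\mathcal{A}=(\mathbb{N},S^{\mathcal{A}})$ be a punctual copy of $(\mathbb{N},S)$ such that the image $+^{\mathcal{A}}$ of addition in $\mathcal{A}$ is primitive recursive, let $\widetilde{\mathcal{A}}$ be the copy obtained from $\mathcal{A}$ by the binary-expansion construction, and let $p(x)=2^x$. Then $p^{\widetilde{\mathcal{A}}}$ is primitive recursive if and only if $p^{\mathcal{A}}$ is primitive recursive.
   Context: $S$ is the successor on $\mathbb{N}$. A punctual copy of $(\mathbb{N},S)$ is $\mathcal{A}=(\mathbb{N},S^{\mathcal{A}})$ isomorphic to $(\mathbb{N},S)$ with $S^{\mathcal{A}}$ primitive recursive; let $c:(\mathbb{N},S)\to\mathcal{A}$ be the isomorphism. For $f:\mathbb{N}^k\to\mathbb{N}$ its image in a copy with isomorphism $d$ is $(x_1,\dots,x_k)\mapsto d(f(d^{ -1}(x_1),\dots,d^{ -1}(x_k)))$; so $p^{\mathcal{A}}=c\circ p\circ c^{ -1}$ and $x+^{\mathcal{A}}y=c(c^{ -1}(x)+c^{ -1}(y))$. Define $\widetilde{c}:\mathbb{N}\to\mathbb{N}$ by $\widetilde{c}(0)=0$ and $\widetilde{c}(2^{i_k}+\dots+2^{i_0}) = 2^{c(i_k)}+\dots+2^{c(i_0)}$ for distinct $i_k>\dots>i_0$. $\widetilde{\mathcal{A}}$ is the copy of $(\mathbb{N},S)$ with isomorphism $\widetilde{c}$, so $p^{\widetilde{\mathcal{A}}}=\widetilde{c}\circ p\circ\widetilde{c}^{ -1}$. -}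

module Defs where

open import Data.Nat using (ℕ; zero; suc; _+_; _*_; _^_; _/_; _%_)
open import Data.Fin using (Fin)
open import Data.Vec using (Vec; []; _∷_; lookup)
open import Data.Product using (Σ; _×_)
open import Relation.Binary.PropositionalEquality using (_≡_)
open import Function.Definitions using (Inverseᵇ)

data PR : ℕ → Set where
  zer  : PR 0
  succ : PR 1
  proj : ∀ {n} → Fin n → PR n
  comp : ∀ {m n} → PR m → Vec (PR n) m → PR n
  rec  : ∀ {n} → PR n → PR (suc (suc n)) → PR (suc n)

mutual
  eval : ∀ {n} → PR n → Vec ℕ n → ℕ
  eval zer xs = 0
  eval succ (x ∷ []) = suc x
  eval (proj i) xs = lookup xs i
  eval (comp f gs) xs = eval f (evalAll gs xs)
  eval (rec f g) (zero ∷ xs) = eval f xs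
  eval (rec f g) (suc y ∷ xs) = eval g (y ∷ eval (rec f g) (y ∷ xs) ∷ xs)

  evalAll : ∀ {m n} → Vec (PR n) m → Vec ℕ n → Vec ℕ m
  evalAll [] xs = []
  evalAll (g ∷ gs) xs = eval g xs ∷ evalAll gs xs

IsPR : (n : ℕ) → (Vec ℕ n → ℕ) → Set
IsPR n f = Σ (PR n) λ t → ∀ xs → eval t xs ≡ f xs

IsPR₁ : (ℕ → ℕ) → Set
IsPR₁ f = IsPR 1 λ { (x ∷ []) → f x }

IsPR₂ : (ℕ → ℕ → ℕ) → Set
IsPR₂ f = IsPR 2 λ { (x ∷ y ∷ []) → f x y }

record PunctualCopy : Set where
  field
    SA     : ℕ → ℕ
    SA-pr  : IsPR₁ SA
    c      : ℕ → ℕ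
    cinv   : ℕ → ℕ
    c-inv  : Inverseᵇ _≡_ _≡_ c cinv
    c-hom  : ∀ n → c (suc n) ≡ SA (c n)

bit : ℕ → ℕ → ℕ
bit n zero = n % 2
bit n (suc i) = bit (n / 2) i

tildeAux : (ℕ → ℕ) → ℕ → ℕ → ℕ
tildeAux c n zero = 0
tildeAux c n (suc k) = tildeAux c n k + bit n k * 2 ^ (c k)

-- binary-expansion construction: tilde c (2^{i_k}+…+2^{i_0}) = 2^{c i_k}+…+2^{c i_0}
-- (all bits of n are below position n, since n < 2^n)
tilde : (ℕ → ℕ) → ℕ → ℕ
tilde c n = tildeAux c n n

image₁ : (ℕ → ℕ) → (ℕ → ℕ) → (ℕ → ℕ) → ℕ → ℕ
image₁ d e f x = d (f (e x))

image₂ : (ℕ → ℕ) → (ℕ → ℕ) → (ℕ → ℕ → ℕ) → ℕ → ℕ → ℕ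
image₂ d e f x y = d (f (e x) (e y))

p : ℕ → ℕ
p x = 2 ^ x

-- The binary-expansion construction sends 2 ^ m to 2 ^ d m, for every d.  Hence
-- p^Ã (2 ^ x) ≡ 2 ^ p^𝒜 x, so p^𝒜 is recovered from p^Ã by reading off the exponent of a
-- power of two (the sum of the positions of its set bits).  Conversely
-- p^Ã x ≡ 2 ^ c (Σ_{i<x} bit(x,i) · 2 ^ c⁻¹ i), and c of this sum is accumulated by
-- primitive recursion over i with +^𝒜, adding p^𝒜 i = c (2 ^ c⁻¹ i) for every set bit i.
module Submission where

open import Defs
open import Data.Nat using (ℕ; zero; suc; _+_; _*_; _^_; _/_; _%_; _≤_; _<_; z≤n; s≤s; s≤s⁻¹)
open import Data.Nat.Properties
open import Data.Nat.DivMod using (m/n≡1+[m∸n]/n; m*n/n≡m; m*n%n≡0; m%n<n)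
open import Data.Nat.GeneralisedArithmetic using (fold; iterate; iterate-is-fold)
open import Data.Fin using (#_)
open import Data.Vec using (Vec; []; _∷_; lookup; map; head; tail)
open import Data.Vec.Relation.Unary.All using (All; []; _∷_)
open import Data.Product using (Σ; _×_; _,_; proj₂)
open import Data.Sum using (inj₁; inj₂)
open import Function using (_$_; _∘_)
open import Relation.Nullary using (contradiction)
open import Relation.Binary.PropositionalEquality

Fn : ℕ → Set
Fn n = Vec ℕ n → ℕ

IsPR-resp-≗ : ∀ {n} {f g : Fn n} → f ≗ g → IsPR n f → IsPR n g
IsPR-resp-≗ f≗g (t , t≗f) = t , λ xs → trans (t≗f xs) (f≗g xs)

IsPR-const : ∀ {n} k → IsPR n (λ _ → k)
IsPR-const zero = comp zer [] , λ _ → refl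
IsPR-const (suc k) with IsPR-const k
... | t , t≗k = comp succ (t ∷ []) , λ xs → cong suc (t≗k xs)

IsPR-suc : IsPR₁ suc
IsPR-suc = succ , λ { (_ ∷ []) → refl }

IsPR-proj : ∀ {n} i → IsPR n (λ xs → lookup xs i)
IsPR-proj i = proj i , λ _ → refl

IsPR-all : ∀ {m n} {gs : Vec (Fn n) m} → All (IsPR n) gs →
           Σ (Vec (PR n) m) λ ts → ∀ xs → evalAll ts xs ≡ map (_$ xs) gs
IsPR-all [] = [] , λ _ → refl
IsPR-all ((t , t≗g) ∷ Pgs) with IsPR-all Pgs
... | ts , ts≗gs = t ∷ ts , λ xs → cong₂ _∷_ (t≗g xs) (ts≗gs xs)

IsPR-∘ : ∀ {m n} {f : Fn m} {gs : Vec (Fn n) m} →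
         IsPR m f → All (IsPR n) gs → IsPR n (λ xs → f (map (_$ xs) gs))
IsPR-∘ (t , t≗f) Pgs with IsPR-all Pgs
... | ts , ts≗gs = comp t ts , λ xs → trans (cong (eval t) (ts≗gs xs)) (t≗f _)

IsPR-rec : ∀ {n} {f : Fn n} {g : Fn (suc (suc n))} {h : ℕ → Fn n} →
           IsPR n f → IsPR (suc (suc n)) g →
           (∀ xs → h 0 xs ≡ f xs) → (∀ y xs → h (suc y) xs ≡ g (y ∷ h y xs ∷ xs)) →
           IsPR (suc n) (λ ys → h (head ys) (tail ys))
IsPR-rec {g = g} {h} (tf , tf≗f) (tg , tg≗g) h-zero h-suc = rec tf tg , correct
  where
  correct : ∀ ys → eval (rec tf tg) ys ≡ h (head ys) (tail ys)
  correct (zero ∷ xs) = trans (tf≗f xs) (sym (h-zero xs))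
  correct (suc y ∷ xs) = begin
    eval tg (y ∷ eval (rec tf tg) (y ∷ xs) ∷ xs)
      ≡⟨ cong (λ r → eval tg (y ∷ r ∷ xs)) (correct (y ∷ xs)) ⟩
    eval tg (y ∷ h y xs ∷ xs)                    ≡⟨ tg≗g _ ⟩
    g (y ∷ h y xs ∷ xs)                          ≡⟨ sym (h-suc y xs) ⟩
    h (suc y) xs                                 ∎
    where open ≡-Reasoning

IsPR-+ : IsPR₂ _+_
IsPR-+ = IsPR-resp-≗ (λ { (_ ∷ _ ∷ []) → refl })
  (IsPR-rec {h = λ x ys → x + head ys} (IsPR-proj (# 0))
            (IsPR-∘ IsPR-suc (IsPR-proj (# 1) ∷ []))
            (λ { (_ ∷ []) → refl }) (λ { _ (_ ∷ []) → refl }))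

IsPR-* : IsPR₂ _*_
IsPR-* = IsPR-resp-≗ (λ { (_ ∷ _ ∷ []) → refl })
  (IsPR-rec {h = λ x ys → x * head ys} (IsPR-const 0)
            (IsPR-∘ IsPR-+ (IsPR-proj (# 2) ∷ IsPR-proj (# 1) ∷ []))
            (λ { (_ ∷ []) → refl }) (λ { _ (_ ∷ []) → refl }))

IsPR-2^ : IsPR₁ (2 ^_)
IsPR-2^ = IsPR-resp-≗ (λ { (_ ∷ []) → refl })
  (IsPR-rec {h = λ x _ → 2 ^ x} (IsPR-const 1)
            (IsPR-∘ IsPR-* (IsPR-const 2 ∷ IsPR-proj (# 1) ∷ []))
            (λ { [] → refl }) (λ { _ [] → refl }))

ifZero : ℕ → ℕ → ℕ → ℕ
ifZero zero    u v = u
ifZero (suc _) u v = v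

ifZero-float : ∀ (f : ℕ → ℕ) b {u v} → f (ifZero b u v) ≡ ifZero b (f u) (f v)
ifZero-float f zero    = refl
ifZero-float f (suc _) = refl

m≤1⇒m*n≡ifZero : ∀ {m} n → m ≤ 1 → m * n ≡ ifZero m 0 n
m≤1⇒m*n≡ifZero n z≤n       = refl
m≤1⇒m*n≡ifZero n (s≤s z≤n) = +-identityʳ n

IsPR-ifZero : IsPR 3 (λ { (b ∷ u ∷ v ∷ []) → ifZero b u v })
IsPR-ifZero = IsPR-resp-≗ (λ { (_ ∷ _ ∷ _ ∷ []) → refl })
  (IsPR-rec {h = λ b ys → ifZero b (head ys) (head (tail ys))} (IsPR-proj (# 0)) (IsPR-proj (# 3))
            (λ { (_ ∷ _ ∷ []) → refl }) (λ { _ (_ ∷ _ ∷ []) → refl }))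

-- Unlike _/_, the builtin _%_ computes suc (suc n) % 2 to n % 2 definitionally.
%2-suc : ∀ n → suc n % 2 ≡ ifZero (n % 2) 1 0
%2-suc zero          = refl
%2-suc (suc zero)    = refl
%2-suc (suc (suc n)) = %2-suc n

/2-suc : ∀ n → suc n / 2 ≡ n / 2 + n % 2
/2-suc zero          = refl
/2-suc (suc zero)    = refl
/2-suc (suc (suc n)) = begin
  suc (suc (suc n)) / 2   ≡⟨ m/n≡1+[m∸n]/n {suc (suc (suc n))} (s≤s (s≤s z≤n)) ⟩
  suc (suc n / 2)         ≡⟨ cong suc (/2-suc n) ⟩
  suc (n / 2 + n % 2)     ≡⟨ cong (_+ n % 2) (m/n≡1+[m∸n]/n {suc (suc n)} (s≤s (s≤s z≤n))) ⟨
  suc (suc n) / 2 + n % 2 ∎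
  where open ≡-Reasoning

IsPR-%2 : IsPR₁ (_% 2)
IsPR-%2 = IsPR-resp-≗ (λ { (_ ∷ []) → refl })
  (IsPR-rec {h = λ n _ → n % 2} (IsPR-const 0)
            (IsPR-∘ IsPR-ifZero (IsPR-proj (# 1) ∷ IsPR-const 1 ∷ IsPR-const 0 ∷ []))
            (λ { [] → refl }) (λ { n [] → %2-suc n }))

IsPR-/2 : IsPR₁ (_/ 2)
IsPR-/2 = IsPR-resp-≗ (λ { (_ ∷ []) → refl })
  (IsPR-rec {h = λ n _ → n / 2} (IsPR-const 0)
            (IsPR-∘ IsPR-+ (IsPR-proj (# 1) ∷ IsPR-∘ IsPR-%2 (IsPR-proj (# 0) ∷ []) ∷ []))
            (λ { [] → refl }) (λ { n [] → /2-suc n }))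

IsPR-fold : ∀ {s : ℕ → ℕ} → IsPR₁ s → IsPR₂ (λ i x → fold x s i)
IsPR-fold {s} Ps = IsPR-resp-≗ (λ { (_ ∷ _ ∷ []) → refl })
  (IsPR-rec {h = λ i ys → fold (head ys) s i} (IsPR-proj (# 0))
            (IsPR-∘ Ps (IsPR-proj (# 1) ∷ []))
            (λ { (_ ∷ []) → refl }) (λ { _ (_ ∷ []) → refl }))

bit≡iterate : ∀ n i → bit n i ≡ iterate (_/ 2) n i % 2
bit≡iterate n zero    = refl
bit≡iterate n (suc i) = bit≡iterate (n / 2) i

IsPR-bit : IsPR₂ (λ i n → bit n i)
IsPR-bit = IsPR-resp-≗
  (λ { (i ∷ n ∷ []) → trans (cong (_% 2) (iterate-is-fold n (_/ 2) i)) (sym (bit≡iterate n i)) })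
  (IsPR-∘ IsPR-%2 (IsPR-fold IsPR-/2 ∷ []))

bit≤1 : ∀ n i → bit n i ≤ 1
bit≤1 n zero    = s≤s⁻¹ (m%n<n n 2)
bit≤1 n (suc i) = bit≤1 (n / 2) i

sumBelow : ℕ → (ℕ → ℕ) → ℕ
sumBelow zero    f = 0
sumBelow (suc k) f = sumBelow k f + f k

sumBelow-zero : ∀ k {f : ℕ → ℕ} → (∀ i → i < k → f i ≡ 0) → sumBelow k f ≡ 0
sumBelow-zero zero    f<k≡0 = refl
sumBelow-zero (suc k) f<k≡0 =
  cong₂ _+_ (sumBelow-zero k (λ i i<k → f<k≡0 i (m<n⇒m<1+n i<k))) (f<k≡0 k ≤-refl)

sumBelow-single : ∀ {m k} {f : ℕ → ℕ} →
                  (∀ i → i ≢ m → f i ≡ 0) → m < k → sumBelow k f ≡ f m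
sumBelow-single {m} {suc k} {f} supp (s≤s m≤k) with m≤n⇒m<n∨m≡n m≤k
... | inj₁ m<k = begin
  sumBelow k f + f k ≡⟨ cong₂ _+_ (sumBelow-single supp m<k) (supp k (≢-sym (<⇒≢ m<k))) ⟩
  f m + 0            ≡⟨ +-identityʳ (f m) ⟩
  f m                ∎
  where open ≡-Reasoning
... | inj₂ refl = cong (_+ f m) (sumBelow-zero m (λ i i<m → supp i (<⇒≢ i<m)))

IsPR-image-sumBelow : ∀ {d e : ℕ → ℕ} {g : ℕ → ℕ → ℕ} → (∀ x → e (d x) ≡ x) →
                      IsPR₂ (image₂ d e _+_) → IsPR₂ (λ i x → d (g i x)) →
                      IsPR₂ (λ k x → d (sumBelow k (λ i → g i x)))
IsPR-image-sumBelow {d} {e} {g} e∘d≗id P+ Pg = IsPR-resp-≗ (λ { (_ ∷ _ ∷ []) → refl })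
  (IsPR-rec {h = λ k ys → d (sumBelow k (λ i → g i (head ys)))} (IsPR-const (d 0))
            (IsPR-∘ P+ (IsPR-proj (# 1) ∷ IsPR-∘ Pg (IsPR-proj (# 0) ∷ IsPR-proj (# 2) ∷ []) ∷ []))
            (λ { (_ ∷ []) → refl })
            (λ { k (x ∷ []) → d-hom (sumBelow k (λ i → g i x)) (g k x) }))
  where
  d-hom : ∀ a b → d (a + b) ≡ image₂ d e _+_ (d a) (d b)
  d-hom a b = sym (cong₂ (λ a′ b′ → d (a′ + b′)) (e∘d≗id a) (e∘d≗id b))

IsPR-sumBelow : ∀ {g : ℕ → ℕ → ℕ} → IsPR₂ g → IsPR₂ (λ k x → sumBelow k (λ i → g i x))
IsPR-sumBelow = IsPR-image-sumBelow {d = λ x → x} {e = λ x → x} (λ _ → refl) IsPR-+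

n<2^n : ∀ n → n < 2 ^ n
n<2^n zero    = s≤s z≤n
n<2^n (suc n) = +-mono-≤ (m^n>0 2 n) (≤-trans (n<2^n n) (m≤m+n (2 ^ n) 0))

bit-0 : ∀ i → bit 0 i ≡ 0
bit-0 zero    = refl
bit-0 (suc i) = bit-0 i

2*n/2≡n : ∀ n → 2 * n / 2 ≡ n
2*n/2≡n n = trans (cong (_/ 2) (*-comm 2 n)) (m*n/n≡m n 2)

2*n%2≡0 : ∀ n → 2 * n % 2 ≡ 0
2*n%2≡0 n = trans (cong (_% 2) (*-comm 2 n)) (m*n%n≡0 n 2)

bit-2^-same : ∀ m → bit (2 ^ m) m ≡ 1
bit-2^-same zero    = refl
bit-2^-same (suc m) = trans (cong (λ y → bit y m) (2*n/2≡n (2 ^ m))) (bit-2^-same m)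

bit-2^-other : ∀ m i → i ≢ m → bit (2 ^ m) i ≡ 0
bit-2^-other zero    zero    i≢m = contradiction refl i≢m
bit-2^-other zero    (suc i) _   = bit-0 i
bit-2^-other (suc m) zero    _   = 2*n%2≡0 (2 ^ m)
bit-2^-other (suc m) (suc i) i≢m =
  trans (cong (λ y → bit y i) (2*n/2≡n (2 ^ m))) (bit-2^-other m i (i≢m ∘ cong suc))

sumBelow-bit-2^ : ∀ (w : ℕ → ℕ) {m k} → m < k → sumBelow k (λ i → bit (2 ^ m) i * w i) ≡ w m
sumBelow-bit-2^ w {m} {k} m<k = begin
  sumBelow k (λ i → bit (2 ^ m) i * w i)
    ≡⟨ sumBelow-single (λ i i≢m → cong (_* w i) (bit-2^-other m i i≢m)) m<k ⟩
  bit (2 ^ m) m * w m                    ≡⟨ cong (_* w m) (bit-2^-same m) ⟩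
  1 * w m                                ≡⟨ *-identityˡ (w m) ⟩
  w m                                    ∎
  where open ≡-Reasoning

tildeAux≡sumBelow : ∀ d n k → tildeAux d n k ≡ sumBelow k (λ i → bit n i * 2 ^ d i)
tildeAux≡sumBelow d n zero    = refl
tildeAux≡sumBelow d n (suc k) = cong (_+ bit n k * 2 ^ d k) (tildeAux≡sumBelow d n k)

tilde-2^ : ∀ d m → tilde d (2 ^ m) ≡ 2 ^ d m
tilde-2^ d m =
  trans (tildeAux≡sumBelow d (2 ^ m) (2 ^ m)) (sumBelow-bit-2^ (λ i → 2 ^ d i) (n<2^n m))

-- Inverts 2 ^_ like ⌊log₂_⌋, but as a bounded sum it is visibly primitive recursive.
bitPositionSum : ℕ → ℕ
bitPositionSum y = sumBelow y (λ i → bit y i * i)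

bitPositionSum-2^ : ∀ m → bitPositionSum (2 ^ m) ≡ m
bitPositionSum-2^ m = sumBelow-bit-2^ (λ i → i) (n<2^n m)

IsPR-bitPositionSum : IsPR₁ bitPositionSum
IsPR-bitPositionSum = IsPR-resp-≗ (λ { (_ ∷ []) → refl })
  (IsPR-∘ (IsPR-sumBelow {g = λ i y → bit y i * i}
            (IsPR-resp-≗ (λ { (_ ∷ _ ∷ []) → refl })
                         (IsPR-∘ IsPR-* (IsPR-bit ∷ IsPR-proj (# 0) ∷ []))))
          (IsPR-proj (# 0) ∷ IsPR-proj (# 0) ∷ []))

image-p-tilde-2^ : ∀ d e x → image₁ (tilde d) (tilde e) p (2 ^ x) ≡ 2 ^ image₁ d e p x
image-p-tilde-2^ d e x = begin
  tilde d (2 ^ tilde e (2 ^ x)) ≡⟨ cong (λ y → tilde d (2 ^ y)) (tilde-2^ e x) ⟩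
  tilde d (2 ^ 2 ^ e x)         ≡⟨ tilde-2^ d (2 ^ e x) ⟩
  2 ^ d (2 ^ e x)               ∎
  where open ≡-Reasoning

image-p-tilde : ∀ d e x →
                image₁ (tilde d) (tilde e) p x ≡ 2 ^ d (sumBelow x (λ i → bit x i * 2 ^ e i))
image-p-tilde d e x =
  trans (tilde-2^ d (tilde e x)) (cong (λ y → 2 ^ d y) (tildeAux≡sumBelow e x x))

image-bit* : ∀ (d : ℕ → ℕ) n i y → d (bit n i * y) ≡ ifZero (bit n i) (d 0) (d y)
image-bit* d n i y = trans (cong d (m≤1⇒m*n≡ifZero y (bit≤1 n i))) (ifZero-float d (bit n i))

IsPR-image-p-from-tilde : ∀ d e → IsPR₁ (image₁ (tilde d) (tilde e) p) → IsPR₁ (image₁ d e p)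
IsPR-image-p-from-tilde d e Pp-tilde = IsPR-resp-≗
  (λ { (x ∷ []) → trans (cong bitPositionSum (image-p-tilde-2^ d e x))
                        (bitPositionSum-2^ (image₁ d e p x)) })
  (IsPR-∘ IsPR-bitPositionSum (IsPR-∘ Pp-tilde (IsPR-∘ IsPR-2^ (IsPR-proj (# 0) ∷ []) ∷ []) ∷ []))

IsPR-image-p-tilde : ∀ d e → (∀ x → e (d x) ≡ x) →
                     IsPR₂ (image₂ d e _+_) → IsPR₁ (image₁ d e p) →
                     IsPR₁ (image₁ (tilde d) (tilde e) p)
IsPR-image-p-tilde d e e∘d≗id P+ Pp = IsPR-resp-≗ (λ { (x ∷ []) → sym (image-p-tilde d e x) })
  (IsPR-∘ IsPR-2^ (IsPR-∘ Psum (IsPR-proj (# 0) ∷ IsPR-proj (# 0) ∷ []) ∷ []))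
  where
  Pterm : IsPR₂ (λ i x → d (bit x i * 2 ^ e i))
  Pterm = IsPR-resp-≗ (λ { (i ∷ x ∷ []) → sym (image-bit* d x i (2 ^ e i)) })
    (IsPR-∘ IsPR-ifZero (IsPR-bit ∷ IsPR-const (d 0) ∷ IsPR-∘ Pp (IsPR-proj (# 0) ∷ []) ∷ []))
  Psum : IsPR₂ (λ k x → d (sumBelow k (λ i → bit x i * 2 ^ e i)))
  Psum = IsPR-image-sumBelow {d} {e} e∘d≗id P+ Pterm

mainTheorem12 : (A : PunctualCopy) → let open PunctualCopy A in
    IsPR₂ (image₂ c cinv _+_) →
    (IsPR₁ (image₁ (tilde c) (tilde cinv) p) → IsPR₁ (image₁ c cinv p))
    × (IsPR₁ (image₁ c cinv p) → IsPR₁ (image₁ (tilde c) (tilde cinv) p))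
mainTheorem12 A P+ =
  IsPR-image-p-from-tilde c cinv , IsPR-image-p-tilde c cinv (λ x → proj₂ c-inv refl) P+
  where open PunctualCopy A
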